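{- Let $m,n$ be positive integers and $t$ a nonnegative integer. If $t\ge m-1$ and $n\ge m$, then $\mathrm{MPF}_{m,n}(t)=\mathrm{PF}_{m,n}$.
   Context: $[n]=\{1,\dots,n\}$. The $t$-metered parking scheme for $\alpha=(a_1,\dots,a_m)\in[n]^m$: there are $n$ spots $1,\dots,n$; cars $1,\dots,m$ arrive in order; car $i$ drives to spot $a_i$, parks there if unoccupied, and otherwise parks in the first unoccupied spot numbered greater than $a_i$; if there is none, the car fails to park. Immediately after car $j$ parks, car $j-t$ (if $j-t\ge1$) leaves. $\mathrm{MPF}_{m,n}(t)$ is the set of $\alpha\in[n]^m$ for which all cars park. For $m\le n$, $\mathrm{PF}_{m,n}$ is the set of $(m,n)$-parking functions: $\alpha\in[n]^m$ such that all cars park under the same rule when no car ever leaves; equivalently, the nondecreasing rearrangement $a'_1\le\dots\le a'_m$ satisfies $a'_i\le n-m+i$ for all $i$. -}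

module Defs where

open import Data.Nat using (ℕ; zero; suc; _≤_; _∸_; _≡ᵇ_; _≤ᵇ_)
open import Data.Bool using (Bool; true; false; if_then_else_)
open import Data.Maybe using (Maybe; just; nothing)
open import Data.List using (List; []; _∷_; replicate)
open import Data.Fin using (Fin; toℕ)
open import Data.Vec using (Vec; toList)
open import Data.Unit using (⊤)
open import Data.Empty using (⊥)

-- Spots are indexed 0,…,n-1 (spot i+1 of the paper is index i); cars are
-- indexed 0,…,m-1 (car j+1 of the paper is index j). A preference a : Fin n
-- stands for the paper's spot toℕ a + 1.
-- The lot is a list of length n; entry = nothing (free) or just c (car c parked).
Lot : Set
Lot = List (Maybe ℕ)

firstFree : Lot → ℕ → Maybe ℕ
firstFree []              k       = nothing
firstFree (nothing ∷ xs)  zero    = just zero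
firstFree (just _ ∷ xs)   zero    = Data.Maybe.map suc (firstFree xs zero)
firstFree (x ∷ xs)        (suc k) = Data.Maybe.map suc (firstFree xs k)

occupy : Lot → ℕ → ℕ → Lot
occupy []       i       c = []
occupy (x ∷ xs) zero    c = just c ∷ xs
occupy (x ∷ xs) (suc i) c = x ∷ occupy xs i c

leave : Lot → ℕ → Lot
leave []              c = []
leave (nothing ∷ xs)  c = nothing ∷ leave xs c
leave (just d ∷ xs)   c = (if d ≡ᵇ c then nothing else just d) ∷ leave xs c

-- run the parking process; `dep j` is the car (if any) that leaves right
-- after car j parks. Result true iff every car parks.
runPark : (ℕ → Maybe ℕ) → ℕ → List ℕ → Lot → Bool
runPark dep j []       lot = true
runPark dep j (a ∷ as) lot with firstFree lot a
... | nothing = false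
... | just i  with dep j
...   | nothing = runPark dep (suc j) as (occupy lot i j)
...   | just c  = runPark dep (suc j) as (leave (occupy lot i j) c)

meteredDep : ℕ → ℕ → Maybe ℕ
meteredDep t j = if t ≤ᵇ j then just (j ∸ t) else nothing

prefs : ∀ {m n} → Vec (Fin n) m → List ℕ
prefs α = Data.List.map toℕ (toList α)

T : Bool → Set
T true  = ⊤
T false = ⊥

MPF : (m n t : ℕ) → Vec (Fin n) m → Set
MPF m n t α = T (runPark (meteredDep t) zero (prefs α) (replicate n nothing))

PF : (m n : ℕ) → Vec (Fin n) m → Set
PF m n α = T (runPark (λ _ → nothing) zero (prefs α) (replicate n nothing))

-- A departure only changes the lot seen by cars arriving after it. The
-- first departure happens right after car t+1 parks, so when t ≥ m-1 it can
-- only follow the last car, and the metered run coincides step by step with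
-- the run without departures.
module Submission where

open import Defs
open import Data.Nat using (ℕ; suc; _+_; _∸_; _≤_; _<_; s≤s; s≤s⁻¹; z<s; _≤?_)
open import Data.Nat.Properties using (<⇒≱; m<m+n; <-≤-trans; +-suc; ≤-trans; m≤n+m∸n)
open import Data.Fin using (Fin; toℕ)
open import Data.Vec using (Vec; toList)
open import Data.Vec.Properties using (length-toList)
open import Data.List using ([]; _∷_; length; replicate)
open import Data.List.Properties using (length-map)
open import Data.Maybe using (Maybe; just; nothing)
open import Data.Product using (_×_; _,_)
open import Relation.Nullary.Decidable using (dec-false)
open import Relation.Binary.PropositionalEquality using (_≡_; refl; sym; trans; cong; subst)
open import Function using (id)

+-suc-≤ : ∀ m n {o} → m + suc n ≤ o → suc m + n ≤ o
+-suc-≤ m n {o} = subst (_≤ o) (+-suc m n)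

runPark-lastCar : ∀ dep dep′ j a lot →
  runPark dep j (a ∷ []) lot ≡ runPark dep′ j (a ∷ []) lot
runPark-lastCar dep dep′ j a lot with firstFree lot a
... | nothing = refl
... | just i with dep j | dep′ j
...   | nothing | nothing = refl
...   | nothing | just _  = refl
...   | just _  | nothing = refl
...   | just _  | just _  = refl

runPark-cong-noDeparture : ∀ {dep dep′ : ℕ → Maybe ℕ} {j} a as lot →
  dep j ≡ nothing → dep′ j ≡ nothing →
  (∀ i → runPark dep (suc j) as (occupy lot i j) ≡ runPark dep′ (suc j) as (occupy lot i j)) →
  runPark dep j (a ∷ as) lot ≡ runPark dep′ j (a ∷ as) lot
runPark-cong-noDeparture a as lot stay stay′ rest with firstFree lot a
... | nothing = refl
... | just i rewrite stay | stay′ = rest i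

runPark-withoutEarlyDepartures :
  ∀ {dep : ℕ → Maybe ℕ} {t} → (∀ i → i < t → dep i ≡ nothing) →
  ∀ j as lot → j + length as ≤ suc t →
  runPark dep j as lot ≡ runPark (λ _ → nothing) j as lot
runPark-withoutEarlyDepartures _ j [] lot _ = refl
runPark-withoutEarlyDepartures {dep} _ j (a ∷ []) lot _ = runPark-lastCar dep _ j a lot
runPark-withoutEarlyDepartures {dep} {t} early j (a ∷ as@(_ ∷ _)) lot bound =
  runPark-cong-noDeparture {dep} a as lot (early j j<t) refl
    (λ i → runPark-withoutEarlyDepartures early (suc j) as (occupy lot i j) bound′)
  where
  bound′ : suc j + length as ≤ suc t
  bound′ = +-suc-≤ j (length as) bound

  j<t : j < t
  j<t = <-≤-trans (m<m+n j z<s) (s≤s⁻¹ bound′)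

meteredDep-early : ∀ t i → i < t → meteredDep t i ≡ nothing
meteredDep-early t i i<t rewrite dec-false (t ≤? i) (<⇒≱ i<t) = refl

length-prefs : ∀ {m n} (α : Vec (Fin n) m) → length (prefs α) ≡ m
length-prefs α = trans (length-map toℕ (toList α)) (length-toList α)

MPF≡PF : ∀ m n t → m ∸ 1 ≤ t → (α : Vec (Fin n) m) → MPF m n t α ≡ PF m n α
MPF≡PF m n t m∸1≤t α = cong T
  (runPark-withoutEarlyDepartures (meteredDep-early t) 0 (prefs α) (replicate n nothing)
    (subst (_≤ suc t) (sym (length-prefs α)) (≤-trans (m≤n+m∸n m 1) (s≤s m∸1≤t))))

proposition2p4 : (m n t : ℕ) → 1 ≤ m → 1 ≤ n → m ∸ 1 ≤ t → m ≤ n →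
    (α : Vec (Fin n) m) → (MPF m n t α → PF m n α) × (PF m n α → MPF m n t α)
proposition2p4 m n t _ _ m∸1≤t _ α =
  subst id (MPF≡PF m n t m∸1≤t α) , subst id (sym (MPF≡PF m n t m∸1≤t α))
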